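{- Let $(V,d)$ be a metric space, $k\ge1$, $S=\{v_1,\dots,v_m\}\subseteq V$ a finite set of points, and $y\in[0,1]^m$ with $\sum_iy_i=k$. Then the output $Y$ of the randomized rounding procedure of the context applied to $y$ has at most $k$ points (with probability $1$).
   Context: $S$ plays the role of the points $R_0\cup\dots\cup R_{t-1}$ seen before time $t$, $y$ the fractional solution. $D(y,x)=\min\{\sum_i\alpha_id(v_i,x):0\le\alpha_i\le y_i,\ \sum_i\alpha_i=1\}$; for a set $Y$, $D(Y,x)=\min_{c\in Y}d(c,x)$, $D(\emptyset,x)=+\infty$; write $y(j)$ for the coordinate of $y$ at point $j\in S$. Randomized rounding. Phase 1: start with $\bar Y=\emptyset$; consider points of $S$ in non-decreasing order of $D(y,\cdot)$; add $i$ to $\bar Y$ if $D(\bar Y,i)>4\,D(y,i)$. Phase 2: for $i\in\bar Y$ let $r_i$ be the distance from $i$ to its closest other point of $\bar Y$ ($r_i=+\infty$ if $|\bar Y|=1$), and $w_i=\sum_{j\in S:\,d(i,j)<r_i/2}y(j)$. Build a matching on $\bar Y$ by repeatedly pairing the two closest unmatched points (at most one point remains unmatched). Order $\bar Y$ as $i_1,\dots,i_{|\bar Y|}$ so that matched points are adjacent and the unmatched point (if any) is last; let $I_s=[\sum_{l<s}w_{i_l},\sum_{l\le s}w_{i_l})$. Draw $\theta$ uniformly from $[0,1)$ and let $Y$ consist of all $i_s$ such that $a+\theta\in I_s$ for some non-negative integer $a$. -}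

module Defs where

open import Level using (0ℓ)
open import Data.Nat as ℕ using (ℕ; zero; suc)
open import Data.Fin using (Fin)
open import Data.List using (List; []; _∷_; _++_; foldr; map; allFin)
open import Data.List.Membership.Propositional using (_∈_)
open import Data.List.Relation.Binary.Permutation.Propositional using (_↭_)
open import Data.Product using (Σ; ∃; ∃-syntax; _×_; _,_)
open import Relation.Binary.PropositionalEquality using (_≡_; _≢_)
open import Relation.Binary.Core using (Rel)
open import Relation.Binary.Structures using (IsTotalOrder)
open import Relation.Nullary using (¬_)
open import Algebra.Core using (Op₁; Op₂)
open import Algebra.Structures using (IsCommutativeRing)

record OrderedField : Set₁ where
  infixl 7 _*_
  infixl 6 _+_
  infix 4 _≤_ _<_
  field
    Carrier : Set
    _+_ _*_ : Op₂ Carrier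
    -_      : Op₁ Carrier
    0# 1#   : Carrier
    _≤_     : Rel Carrier 0ℓ
    isCommutativeRing : IsCommutativeRing _≡_ _+_ _*_ -_ 0# 1#
    isTotalOrder      : IsTotalOrder _≡_ _≤_
    +-mono-≤ : ∀ {x y} z → x ≤ y → x + z ≤ y + z
    *-nonneg : ∀ {x y} → 0# ≤ x → 0# ≤ y → 0# ≤ x * y
    0≢1      : 0# ≢ 1#
    inverse  : ∀ x → x ≢ 0# → ∃[ z ] (x * z ≡ 1#)

  _<_ : Rel Carrier 0ℓ
  x < y = x ≤ y × x ≢ y

  fromℕ : ℕ → Carrier
  fromℕ zero    = 0#
  fromℕ (suc n) = 1# + fromℕ n

  sumL : List Carrier → Carrier
  sumL = foldr _+_ 0#

  ∑ : ∀ {m} → (Fin m → Carrier) → Carrier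
  ∑ {m} f = sumL (map f (allFin m))

record MetricSpace (F : OrderedField) : Set₁ where
  open OrderedField F
  field
    Point   : Set
    d       : Point → Point → Carrier
    d-nonneg : ∀ x y → 0# ≤ d x y
    d-refl  : ∀ x → d x x ≡ 0#
    d-zero  : ∀ x y → d x y ≡ 0# → x ≡ y
    d-sym   : ∀ x y → d x y ≡ d y x
    d-tri   : ∀ x y z → d x z ≤ d x y + d y z

module Rounding {F : OrderedField} (M : MetricSpace F)
                {m : ℕ} (v : Fin m → MetricSpace.Point M)
                (y : Fin m → OrderedField.Carrier F) where
  open OrderedField F
  open MetricSpace M

  Feasible : (Fin m → Carrier) → Set
  Feasible α = (∀ i → 0# ≤ α i × α i ≤ y i) × ∑ α ≡ 1#

  IsD : Point → Carrier → Set
  IsD x δ = (∃[ α ] (Feasible α × ∑ (λ i → α i * d (v i) x) ≡ δ))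
          × (∀ α → Feasible α → δ ≤ ∑ (λ i → α i * d (v i) x))

  -- Phase 1, given the values Dv i = D(y, v_i).
  -- D(Ȳ, v_i) > 4 D(y, v_i)  (with D(∅,·) = +∞) unfolds to:
  Far : (Fin m → Carrier) → List (Fin m) → Fin m → Set
  Far Dv Ȳ i = ∀ c → c ∈ Ȳ → fromℕ 4 * Dv i < d (v c) (v i)

  -- Phase1 Dv acc todo out : processing the points of 'todo' in the
  -- given order, starting from the current set 'acc', yields 'out'.
  data Phase1 (Dv : Fin m → Carrier) (acc : List (Fin m)) :
              List (Fin m) → List (Fin m) → Set where
    done : Phase1 Dv acc [] acc
    add  : ∀ {i rest out} → Far Dv acc i →
           Phase1 Dv (acc ++ (i ∷ [])) rest out → Phase1 Dv acc (i ∷ rest) out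
    skip : ∀ {i rest out} → ¬ Far Dv acc i →
           Phase1 Dv acc rest out → Phase1 Dv acc (i ∷ rest) out

  -- Phase 2.
  -- d(v_i, v_j) < r_i / 2, where r_i = min over the other points c of Ȳ
  -- of d(v_i, v_c) (r_i = +∞ if Ȳ = {i}), unfolds to:
  InBall : List (Fin m) → Fin m → Fin m → Set
  InBall Ȳ i j = ∀ c → c ∈ Ȳ → c ≢ i → d (v i) (v j) + d (v i) (v j) < d (v i) (v c)

  data SumWhere {A : Set} (P : A → Set) (f : A → Carrier) :
                List A → Carrier → Set where
    nil : SumWhere P f [] 0#
    yes : ∀ {a as s} → P a → SumWhere P f as s → SumWhere P f (a ∷ as) (f a + s)
    no  : ∀ {a as s} → ¬ P a → SumWhere P f as s → SumWhere P f (a ∷ as) s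

  IsW : List (Fin m) → Fin m → Carrier → Set
  IsW Ȳ i w = SumWhere (InBall Ȳ i) y (allFin m) w

  -- Greedy matching: Match U ps l : starting with unmatched points U,
  -- repeatedly pairing two closest unmatched points gives the pairs ps,
  -- leaving the list l (of length ≤ 1) unmatched.
  data Match : List (Fin m) → List (Fin m × Fin m) → List (Fin m) → Set where
    none   : Match [] [] []
    single : ∀ {i} → Match (i ∷ []) [] (i ∷ [])
    pair   : ∀ {U U′ i j ps l} → U ↭ (i ∷ j ∷ U′) →
             (∀ a b → a ∈ U → b ∈ U → a ≢ b → d (v i) (v j) ≤ d (v a) (v b)) →
             Match U′ ps l → Match U ((i , j) ∷ ps) l

  data PairsListing : List (Fin m × Fin m) → List (Fin m) → Set where
    []    : PairsListing [] []
    keep : ∀ {i j ps o} → PairsListing ps o →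
           PairsListing ((i , j) ∷ ps) (i ∷ j ∷ o)
    swap : ∀ {i j ps o} → PairsListing ps o →
           PairsListing ((i , j) ∷ ps) (j ∷ i ∷ o)

  -- Admissible ordering i_1,…,i_n of Ȳ: matched points adjacent,
  -- unmatched point (if any) last.
  Ordering : List (Fin m) → List (Fin m) → Set
  Ordering Ȳ ord = ∃[ ps ] ∃[ l ] ∃[ ps′ ] ∃[ o ]
    (Match Ȳ ps l × ps′ ↭ ps × PairsListing ps′ o × ord ≡ o ++ l)

  -- i ∈ Y: i = i_s and a + θ ∈ I_s = [∑_{l<s} w, ∑_{l≤s} w) for some a ∈ ℕ
  InY : (Fin m → Carrier) → List (Fin m) → Carrier → Fin m → Set
  InY w ord θ i = ∃[ pre ] ∃[ post ] ∃[ a ]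
    (ord ≡ pre ++ (i ∷ post)
     × sumL (map w pre) ≤ fromℕ a + θ
     × fromℕ a + θ < sumL (map w pre) + w i)

-- The chosen points are the indices s whose segment I_s = [W_{<s}, W_{<s} + w_{i_s}) contains
-- some a + θ with a ∈ ℕ.  These segments are disjoint, so distinct chosen points need distinct
-- values of a, and a + θ < ∑_s w_{i_s} forces a < k once we know ∑_s w_{i_s} ≤ ∑_j y_j = k.
-- That last bound holds because the balls of radius r_i/2 about distinct points i of Ȳ are
-- disjoint (triangle inequality), so every y_j is counted in at most one w_i.
module Submission where

open import Defs
open import Level using (0ℓ)
open import Algebra.Bundles using (CommutativeRing)
open import Algebra.Structures using (IsCommutativeRing)
import Algebra.Properties.Ring as RingProperties
import Algebra.Properties.CommutativeSemigroup as CommutativeSemigroupProperties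
open import Relation.Binary.Bundles using (Poset)
open import Relation.Binary.Structures using (IsTotalOrder)
import Relation.Binary.Construct.NonStrictToStrict as NonStrictToStrict
import Relation.Binary.Reasoning.PartialOrder as PartialOrderReasoning
open import Data.Nat as ℕ using (ℕ; zero; suc; z≤n; s≤s)
import Data.Nat.Properties as ℕ
open import Data.Fin using (Fin)
open import Data.List using (List; []; _∷_; _++_; map; length; allFin; upTo)
open import Data.List.Properties using (++-identityʳ; ++-assoc; map-++; map-cong; map-cong-local; ∷-injective; length-upTo)
open import Data.List.Membership.Propositional using (_∈_)
open import Data.List.Membership.Propositional.Properties using (∈-∃++; ∈-upTo⁺)
open import Data.List.Relation.Unary.Any using (here; there)
open import Data.List.Relation.Unary.All as All using (All; []; _∷_)
open import Data.List.Relation.Unary.AllPairs using (AllPairs; []; _∷_)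
open import Data.List.Relation.Unary.Unique.Propositional using (Unique)
open import Data.List.Relation.Unary.Unique.Propositional.Properties using (allFin⁺)
open import Data.List.Relation.Binary.Permutation.Propositional
  using (_↭_; refl; prep; swap; trans; ↭-sym; ↭⇒↭ₛ)
open import Data.List.Relation.Binary.Permutation.Propositional.Properties
  using (∈-resp-↭; shift; shifts; ++⁺ʳ; ++⁺ˡ; ↭-length; map⁺)
import Data.List.Relation.Binary.Permutation.Setoid.Properties as SetoidPermutation
open import Data.Product using (∃-syntax; _×_; _,_; proj₁; proj₂)
open import Data.Sum using (_⊎_; inj₁; inj₂)
open import Data.Empty using (⊥-elim)
open import Relation.Nullary using (¬_)
open import Relation.Unary using (_⊥_)
open import Function using (Injective; _on_)
import Relation.Binary.PropositionalEquality as ≡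
open import Relation.Binary.PropositionalEquality
  using (_≡_; _≢_; refl; sym; cong; cong₂; subst; subst₂; setoid; module ≡-Reasoning)

unique-resp-↭ : {A : Set} {xs ys : List A} → xs ↭ ys → Unique xs → Unique ys
unique-resp-↭ {A} p = SetoidPermutation.Unique-resp-↭ (setoid A) (↭⇒↭ₛ p)

unique-drop-mid : {A : Set} (xs : List A) {x : A} {ys : List A} →
                  Unique (xs ++ x ∷ ys) → Unique (xs ++ ys)
unique-drop-mid xs {x} {ys} u with _ ∷ u′ ← unique-resp-↭ (shift x xs ys) u = u′

allPairs-of-members : {A : Set} {R : A → A → Set} {xs : List A} →
                      (∀ {x x′} → x ∈ xs → x′ ∈ xs → x ≢ x′ → R x x′) →
                      Unique xs → AllPairs R xs
allPairs-of-members R-members [] = []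
allPairs-of-members R-members (x∉xs ∷ xs!) =
  All.tabulate (λ x′∈ → R-members (here refl) (there x′∈) (All.lookup x∉xs x′∈))
  ∷ allPairs-of-members (λ x∈ x′∈ → R-members (there x∈) (there x′∈)) xs!

unique-length-≤ : {A B : Set} (R : A → B → Set) → (∀ {x x′ b} → R x b → R x′ b → x ≡ x′) →
                  ∀ (bs : List B) {xs} → Unique xs → All (λ x → ∃[ b ] (b ∈ bs × R x b)) xs →
                  length xs ℕ.≤ length bs
unique-length-≤ R R-functional bs [] [] = z≤n
unique-length-≤ R R-functional bs {x ∷ xs} (x∉xs ∷ xs!) ((b , b∈bs , xRb) ∷ xs⊆bs)
  with ys , zs , refl ← ∈-∃++ b∈bs =
  subst (suc (length xs) ℕ.≤_) (↭-length (↭-sym (shift b ys zs)))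
    (s≤s (unique-length-≤ R R-functional (ys ++ zs) xs! (All.zipWith avoid-b (x∉xs , xs⊆bs))))
  where
  avoid-b : ∀ {x′} → x ≢ x′ × ∃[ b′ ] (b′ ∈ ys ++ b ∷ zs × R x′ b′) →
            ∃[ b′ ] (b′ ∈ ys ++ zs × R x′ b′)
  avoid-b (x≢x′ , b′ , b′∈ , x′Rb′) with ∈-resp-↭ (shift b ys zs) b′∈
  ... | here refl = ⊥-elim (x≢x′ (R-functional xRb x′Rb′))
  ... | there b′∈′ = b′ , b′∈′ , x′Rb′

flatten : {A : Set} → List (A × A) → List A
flatten [] = []
flatten ((i , j) ∷ ps) = i ∷ j ∷ flatten ps

flatten-↭ : {A : Set} {ps qs : List (A × A)} → ps ↭ qs → flatten ps ↭ flatten qs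
flatten-↭ refl = refl
flatten-↭ (prep (i , j) p) = prep i (prep j (flatten-↭ p))
flatten-↭ (swap (a , b) (c , d) p) =
  trans (shifts (a ∷ b ∷ []) (c ∷ d ∷ [])) (++⁺ˡ (c ∷ d ∷ a ∷ b ∷ []) (flatten-↭ p))
flatten-↭ (trans p q) = trans (flatten-↭ p) (flatten-↭ q)

module OrderedFieldProperties (F : OrderedField) where
  open OrderedField F
  open IsCommutativeRing isCommutativeRing
    using (+-assoc; +-comm; +-identityˡ; +-identityʳ; -‿inverseʳ; +-isCommutativeMonoid) public
  open IsTotalOrder isTotalOrder
    using (antisym; total; isPartialOrder)
    renaming (refl to ≤-refl; reflexive to ≤-reflexive; trans to ≤-trans) public

  commutativeRing : CommutativeRing 0ℓ 0ℓ
  commutativeRing = record { isCommutativeRing = isCommutativeRing }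

  open RingProperties (CommutativeRing.ring commutativeRing) using (+-cancelʳ; -1*x≈-x; -‿involutive)
  open CommutativeSemigroupProperties (CommutativeRing.+-commutativeSemigroup commutativeRing)
    using (interchange; x∙yz≈y∙xz) public

  poset : Poset 0ℓ 0ℓ 0ℓ
  poset = record { isPartialOrder = isPartialOrder }

  module ≤-Reasoning = PartialOrderReasoning poset

  <-irrefl : ∀ {x} → ¬ x < x
  <-irrefl (_ , x≢x) = x≢x refl

  <-≤-trans : ∀ {x y z} → x < y → y ≤ z → x < z
  <-≤-trans = NonStrictToStrict.<-≤-trans _≡_ _≤_ sym ≤-trans antisym (λ { refl p → p })

  +-monoʳ-≤ : ∀ {x y} z → x ≤ y → z + x ≤ z + y
  +-monoʳ-≤ {x} {y} z x≤y = subst₂ _≤_ (+-comm x z) (+-comm y z) (+-mono-≤ z x≤y)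

  +-mono-≤-≤ : ∀ {x y u v} → x ≤ y → u ≤ v → x + u ≤ y + v
  +-mono-≤-≤ {y = y} {u} x≤y u≤v = ≤-trans (+-mono-≤ u x≤y) (+-monoʳ-≤ y u≤v)

  +-monoˡ-< : ∀ {x y} z → x < y → x + z < y + z
  +-monoˡ-< {x} {y} z (x≤y , x≢y) = +-mono-≤ z x≤y , λ eq → x≢y (+-cancelʳ z x y eq)

  +-mono-<-< : ∀ {x y u v} → x < y → u < v → x + u < y + v
  +-mono-<-< {y = y} {u} x<y (u≤v , _) = <-≤-trans (+-monoˡ-< u x<y) (+-monoʳ-≤ y u≤v)

  x≤x+y : ∀ {x y} → 0# ≤ y → x ≤ x + y
  x≤x+y {x} {y} 0≤y = subst (_≤ x + y) (+-identityʳ x) (+-monoʳ-≤ x 0≤y)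

  0≤x+y : ∀ {x y} → 0# ≤ x → 0# ≤ y → 0# ≤ x + y
  0≤x+y 0≤x 0≤y = ≤-trans 0≤x (x≤x+y 0≤y)

  -- If 1 ≤ 0 then 0 ≤ -1, hence 0 ≤ (-1)(-1) = 1, contradicting 0 ≢ 1.
  0≤1 : 0# ≤ 1#
  0≤1 with total 0# 1#
  ... | inj₁ 0≤1 = 0≤1
  ... | inj₂ 1≤0 = ⊥-elim (0≢1 (antisym 0≤1′ 1≤0))
    where
    0≤-1 : 0# ≤ - 1#
    0≤-1 = subst₂ _≤_ (-‿inverseʳ 1#) (+-identityˡ (- 1#)) (+-mono-≤ (- 1#) 1≤0)
    0≤1′ : 0# ≤ 1#
    0≤1′ = subst (0# ≤_) (≡.trans (-1*x≈-x (- 1#)) (-‿involutive 1#)) (*-nonneg 0≤-1 0≤-1)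

  fromℕ-nonneg : ∀ n → 0# ≤ fromℕ n
  fromℕ-nonneg zero = ≤-refl
  fromℕ-nonneg (suc n) = 0≤x+y 0≤1 (fromℕ-nonneg n)

  fromℕ-mono : ∀ {a b} → a ℕ.≤ b → fromℕ a ≤ fromℕ b
  fromℕ-mono {b = b} z≤n = fromℕ-nonneg b
  fromℕ-mono (s≤s a≤b) = +-monoʳ-≤ 1# (fromℕ-mono a≤b)

  fromℕ+nonneg<fromℕ⇒< : ∀ {a k θ} → 0# ≤ θ → fromℕ a + θ < fromℕ k → a ℕ.< k
  fromℕ+nonneg<fromℕ⇒< {a} {k} 0≤θ a+θ<k with ℕ.<-≤-connex a k
  ... | inj₁ a<k = a<k
  ... | inj₂ k≤a = ⊥-elim (<-irrefl (<-≤-trans a+θ<k (≤-trans (fromℕ-mono k≤a) (x≤x+y 0≤θ))))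

  sumL-++ : ∀ xs ys → sumL (xs ++ ys) ≡ sumL xs + sumL ys
  sumL-++ [] ys = sym (+-identityˡ (sumL ys))
  sumL-++ (x ∷ xs) ys = ≡.trans (cong (x +_) (sumL-++ xs ys)) (sym (+-assoc x (sumL xs) (sumL ys)))

  sumL-↭ : ∀ {xs ys} → xs ↭ ys → sumL xs ≡ sumL ys
  sumL-↭ p = SetoidPermutation.foldr-commMonoid (setoid Carrier) +-isCommutativeMonoid (↭⇒↭ₛ p)

  NonNegative : {A : Set} → (A → Carrier) → Set
  NonNegative f = ∀ a → 0# ≤ f a

  sumL-map-nonneg : {A : Set} {f : A → Carrier} → NonNegative f → ∀ xs → 0# ≤ sumL (map f xs)
  sumL-map-nonneg f≥0 [] = ≤-refl
  sumL-map-nonneg f≥0 (x ∷ xs) = 0≤x+y (f≥0 x) (sumL-map-nonneg f≥0 xs)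

  InSegment : Carrier → Carrier → Carrier → Set
  InSegment start len x = start ≤ x × x < start + len

  InInterval : {A : Set} → (A → Carrier) → List A → Carrier → A → Set
  InInterval w ord x i = ∃[ pre ] ∃[ post ]
    (ord ≡ pre ++ i ∷ post × InSegment (sumL (map w pre)) (w i) x)

  module _ {A : Set} {w : A → Carrier} (w≥0 : NonNegative w) where

    private
      W : List A → Carrier
      W xs = sumL (map w xs)

    segment-ends-before : ∀ c b p {len x} → InSegment (c + W []) (w b) x → ¬ InSegment (c + W (b ∷ p)) len x
    segment-ends-before c b p {x = x} (_ , x<) (≤x , _) = <-irrefl (<-≤-trans x< (begin
      c + 0# + w b     ≡⟨ cong (_+ w b) (+-identityʳ c) ⟩
      c + w b          ≤⟨ +-monoʳ-≤ c (x≤x+y (sumL-map-nonneg w≥0 p)) ⟩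
      c + W (b ∷ p)    ≤⟨ ≤x ⟩
      x                ∎))
      where open ≤-Reasoning

    -- The offset c is the total weight of an already discarded common prefix.
    shifted-segments-disjoint :
      ∀ c pre₁ pre₂ {i j post₁ post₂ x} → pre₁ ++ i ∷ post₁ ≡ pre₂ ++ j ∷ post₂ →
      InSegment (c + W pre₁) (w i) x → InSegment (c + W pre₂) (w j) x → i ≡ j
    shifted-segments-disjoint c [] [] refl _ _ = refl
    shifted-segments-disjoint c [] (b ∷ pre₂) refl s₁ s₂ = ⊥-elim (segment-ends-before c b pre₂ s₁ s₂)
    shifted-segments-disjoint c (b ∷ pre₁) [] refl s₁ s₂ = ⊥-elim (segment-ends-before c b pre₁ s₂ s₁)
    shifted-segments-disjoint c (b ∷ pre₁) (b′ ∷ pre₂) eq s₁ s₂ with refl , eq′ ← ∷-injective eq =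
      shifted-segments-disjoint (c + w b) pre₁ pre₂ eq′ (regroup pre₁ s₁) (regroup pre₂ s₂)
      where
      regroup : ∀ p {len x} → InSegment (c + W (b ∷ p)) len x → InSegment (c + w b + W p) len x
      regroup p = subst (λ t → InSegment t _ _) (sym (+-assoc c (w b) (W p)))

    inInterval-functional : ∀ {ord x i j} → InInterval w ord x i → InInterval w ord x j → i ≡ j
    inInterval-functional (pre₁ , _ , split₁ , s₁) (pre₂ , _ , split₂ , s₂) =
      shifted-segments-disjoint 0# pre₁ pre₂ (≡.trans (sym split₁) split₂) (from-0 s₁) (from-0 s₂)
      where
      from-0 : ∀ {start len x} → InSegment start len x → InSegment (0# + start) len x
      from-0 = subst (λ t → InSegment t _ _) (sym (+-identityˡ _))

    inInterval⇒<total : ∀ {ord x i} → InInterval w ord x i → x < W ord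
    inInterval⇒<total {i = i} (pre , post , refl , _ , x<) = <-≤-trans x< (begin
      W pre + w i              ≤⟨ +-monoʳ-≤ (W pre) (x≤x+y (sumL-map-nonneg w≥0 post)) ⟩
      W pre + W (i ∷ post)     ≡⟨ sumL-++ (map w pre) (map w (i ∷ post)) ⟨
      sumL (map w pre ++ map w (i ∷ post)) ≡⟨ cong sumL (map-++ w pre (i ∷ post)) ⟨
      W (pre ++ i ∷ post)      ∎)
      where open ≤-Reasoning

module RoundingProperties {F : OrderedField} (M : MetricSpace F) {m : ℕ}
                          (v : Fin m → MetricSpace.Point M) (y : Fin m → OrderedField.Carrier F) where
  open OrderedField F
  open MetricSpace M
  open Rounding M v y
  open OrderedFieldProperties F

  module _ {A : Set} {P : A → Set} {f : A → Carrier} where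

    sumWhere-nonneg : ∀ {xs s} → NonNegative f → SumWhere P f xs s → 0# ≤ s
    sumWhere-nonneg f≥0 nil = ≤-refl
    sumWhere-nonneg f≥0 (yes {a = a} _ sw) = 0≤x+y (f≥0 a) (sumWhere-nonneg f≥0 sw)
    sumWhere-nonneg f≥0 (no _ sw) = sumWhere-nonneg f≥0 sw

    sumWhere-[] : ∀ {s} → SumWhere P f [] s → s ≡ 0#
    sumWhere-[] nil = refl

    sumWhere-∷ : ∀ {a as s} → SumWhere P f (a ∷ as) s →
                 ∃[ t ] (SumWhere P f as t × (s ≡ t ⊎ P a × s ≡ f a + t))
    sumWhere-∷ (yes {s = t} Pa sw) = t , sw , inj₂ (Pa , refl)
    sumWhere-∷ (no {s = t} _ sw) = t , sw , inj₁ refl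

  module _ {A B : Set} {P : B → A → Set} {f : A → Carrier} (f≥0 : NonNegative f) where

    -- s i and t i are the sums over a ∷ as and over as; by disjointness at most one i gains f a.
    sum-peel-≤ : ∀ {a} {s t : B → Carrier} → (∀ i → s i ≡ t i ⊎ P i a × s i ≡ f a + t i) →
                 ∀ L → AllPairs (_⊥_ on P) L → sumL (map s L) ≤ f a + sumL (map t L)
    sum-peel-≤ {a} steps [] [] = 0≤x+y (f≥0 a) ≤-refl
    sum-peel-≤ {a} {s} {t} steps (i ∷ L) (_ ∷ L-disjoint) with steps i
    ... | inj₁ sᵢ≡tᵢ = begin
      s i + sumL (map s L)         ≤⟨ +-monoʳ-≤ (s i) (sum-peel-≤ steps L L-disjoint) ⟩
      s i + (f a + sumL (map t L)) ≡⟨ cong (_+ _) sᵢ≡tᵢ ⟩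
      t i + (f a + sumL (map t L)) ≡⟨ x∙yz≈y∙xz (t i) (f a) _ ⟩
      f a + sumL (map t (i ∷ L))   ∎
      where open ≤-Reasoning
    sum-peel-≤ {a} {s} {t} steps (i ∷ L) (i⊥L ∷ _) | inj₂ (Pia , sᵢ≡) = ≤-reflexive (begin
      s i + sumL (map s L)         ≡⟨ cong₂ _+_ sᵢ≡ (cong sumL (map-cong-local (All.map untouched i⊥L))) ⟩
      f a + t i + sumL (map t L)   ≡⟨ +-assoc (f a) (t i) _ ⟩
      f a + sumL (map t (i ∷ L))   ∎)
      where
      open ≡-Reasoning
      untouched : ∀ {j} → P i ⊥ P j → s j ≡ t j
      untouched {j} i⊥j with steps j
      ... | inj₁ sⱼ≡tⱼ = sⱼ≡tⱼ
      ... | inj₂ (Pja , _) = ⊥-elim (i⊥j (Pia , Pja))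

    disjoint-sumWheres-≤ : ∀ xs L {s : B → Carrier} → (∀ i → SumWhere (P i) f xs (s i)) →
                           AllPairs (_⊥_ on P) L → sumL (map s L) ≤ sumL (map f xs)
    disjoint-sumWheres-≤ [] L sums _ =
      ≤-reflexive (≡.trans (cong sumL (map-cong (λ i → sumWhere-[] (sums i)) L)) (sumL-zeros L))
      where
      sumL-zeros : ∀ (L : List B) → sumL (map (λ _ → 0#) L) ≡ 0#
      sumL-zeros [] = refl
      sumL-zeros (_ ∷ L) = ≡.trans (+-identityˡ _) (sumL-zeros L)
    disjoint-sumWheres-≤ (a ∷ as) L sums L-disjoint =
      ≤-trans (sum-peel-≤ (λ i → proj₂ (proj₂ (sumWhere-∷ (sums i)))) L L-disjoint)
              (+-monoʳ-≤ (f a) (disjoint-sumWheres-≤ as L (λ i → proj₁ (proj₂ (sumWhere-∷ (sums i)))) L-disjoint))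

  inBall-disjoint : ∀ {Ȳ i i′} → i ∈ Ȳ → i′ ∈ Ȳ → i ≢ i′ → InBall Ȳ i ⊥ InBall Ȳ i′
  inBall-disjoint {Ȳ} {i} {i′} i∈Ȳ i′∈Ȳ i≢i′ {j} (j∈Bᵢ , j∈Bᵢ′) =
    <-irrefl (<-≤-trans (+-mono-<-< 2A<D 2B<D) (begin
      D + D                 ≤⟨ +-mono-≤-≤ D≤A+B D≤A+B ⟩
      (A + B) + (A + B)     ≡⟨ interchange A B A B ⟩
      (A + A) + (B + B)     ∎))
    where
    open ≤-Reasoning
    A B D : Carrier
    A = d (v i) (v j)
    B = d (v i′) (v j)
    D = d (v i) (v i′)
    2A<D : A + A < D
    2A<D = j∈Bᵢ i′ i′∈Ȳ (λ i′≡i → i≢i′ (sym i′≡i))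
    2B<D : B + B < D
    2B<D = subst (B + B <_) (d-sym (v i′) (v i)) (j∈Bᵢ′ i i∈Ȳ i≢i′)
    D≤A+B : D ≤ A + B
    D≤A+B = subst (λ t → D ≤ A + t) (d-sym (v j) (v i′)) (d-tri (v i) (v j) (v i′))

  phase1-unique : ∀ {Dv acc todo out} → Phase1 Dv acc todo out → Unique (acc ++ todo) → Unique out
  phase1-unique {acc = acc} done u = subst Unique (++-identityʳ acc) u
  phase1-unique {acc = acc} (add {i = i} {rest} _ p) u =
    phase1-unique p (subst Unique (sym (++-assoc acc (i ∷ []) rest)) u)
  phase1-unique {acc = acc} (skip _ p) u = phase1-unique p (unique-drop-mid acc u)

  match-↭ : ∀ {U ps l} → Match U ps l → U ↭ flatten ps ++ l
  match-↭ none = refl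
  match-↭ single = refl
  match-↭ (pair {i = i} {j} U↭ _ mt) = trans U↭ (prep i (prep j (match-↭ mt)))

  pairsListing-↭ : ∀ {ps o} → PairsListing ps o → o ↭ flatten ps
  pairsListing-↭ [] = refl
  pairsListing-↭ (keep {i = i} {j} pl) = prep i (prep j (pairsListing-↭ pl))
  pairsListing-↭ (swap {i = i} {j} pl) = swap j i (pairsListing-↭ pl)

  ordering-↭ : ∀ {Ȳ ord} → Ordering Ȳ ord → ord ↭ Ȳ
  ordering-↭ (_ , l , _ , _ , mt , ps′↭ps , pl , refl) =
    trans (++⁺ʳ l (trans (pairsListing-↭ pl) (flatten-↭ ps′↭ps))) (↭-sym (match-↭ mt))

  ordering-weight-≤ : ∀ {Ȳ ord w} → NonNegative y → Unique Ȳ → (∀ i → IsW Ȳ i (w i)) →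
                      Ordering Ȳ ord → sumL (map w ord) ≤ ∑ y
  ordering-weight-≤ {Ȳ} {ord} {w} y≥0 Ȳ! isW ordering = begin
    sumL (map w ord)    ≡⟨ sumL-↭ (map⁺ w (ordering-↭ ordering)) ⟩
    sumL (map w Ȳ)      ≤⟨ disjoint-sumWheres-≤ y≥0 (allFin m) Ȳ isW (allPairs-of-members inBall-disjoint Ȳ!) ⟩
    ∑ y                 ∎
    where open ≤-Reasoning

  inY⇒inInterval : ∀ {k w ord θ i} → NonNegative w → 0# ≤ θ → sumL (map w ord) ≤ fromℕ k →
                   InY w ord θ i → ∃[ a ] (a ∈ upTo k × InInterval w ord (fromℕ a + θ) i)
  inY⇒inInterval {w = w} {ord} {θ} {i} w≥0 0≤θ W≤k (pre , post , a , split , a+θ∈I) =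
    a , ∈-upTo⁺ (fromℕ+nonneg<fromℕ⇒< 0≤θ (<-≤-trans (inInterval⇒<total w≥0 a+θ∈Iᵢ) W≤k)) , a+θ∈Iᵢ
    where
    a+θ∈Iᵢ : InInterval w ord (fromℕ a + θ) i
    a+θ∈Iᵢ = pre , post , split , a+θ∈I

open import Data.Nat using (_≤_)

lemma8 : (F : OrderedField) (M : MetricSpace F) (k : ℕ) → 1 ≤ k →
  (m : ℕ) (v : Fin m → MetricSpace.Point M) → Injective _≡_ _≡_ v →
  (y : Fin m → OrderedField.Carrier F) →
  (∀ i → OrderedField._≤_ F (OrderedField.0# F) (y i) × OrderedField._≤_ F (y i) (OrderedField.1# F)) →
  OrderedField.∑ F y ≡ OrderedField.fromℕ F k →
  (Dv : Fin m → OrderedField.Carrier F) → (∀ i → Rounding.IsD M v y (v i) (Dv i)) →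
  (order : List (Fin m)) → order ↭ allFin m →
  AllPairs (λ i j → OrderedField._≤_ F (Dv i) (Dv j)) order →
  (Ȳ : List (Fin m)) → Rounding.Phase1 M v y Dv [] order Ȳ →
  (w : Fin m → OrderedField.Carrier F) → (∀ i → Rounding.IsW M v y Ȳ i (w i)) →
  (ord : List (Fin m)) → Rounding.Ordering M v y Ȳ ord →
  (θ : OrderedField.Carrier F) →
  OrderedField._≤_ F (OrderedField.0# F) θ → OrderedField._<_ F θ (OrderedField.1# F) →
  (Z : List (Fin m)) → Unique Z → All (Rounding.InY M v y w ord θ) Z →
  length Z ≤ k
lemma8 F M k _ m v _ y y∈[0,1] ∑y≡k Dv _ order order↭S _ Ȳ phase1 w isW ord ordering θ 0≤θ _ Z Z! Z⊆Y =
  subst (length Z ≤_) (length-upTo k)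
    (unique-length-≤ _ (inInterval-functional w≥0) (upTo k) Z! (All.map (inY⇒inInterval w≥0 0≤θ W≤k) Z⊆Y))
  where
  module F = OrderedField F
  open OrderedFieldProperties F using (NonNegative; ≤-trans; ≤-reflexive; inInterval-functional)
  open RoundingProperties M v y
  y≥0 : NonNegative y
  y≥0 j = proj₁ (y∈[0,1] j)
  w≥0 : NonNegative w
  w≥0 i = sumWhere-nonneg y≥0 (isW i)
  Ȳ! : Unique Ȳ
  Ȳ! = phase1-unique phase1 (unique-resp-↭ (↭-sym order↭S) (allFin⁺ m))
  W≤k : F.sumL (map w ord) F.≤ F.fromℕ k
  W≤k = ≤-trans (ordering-weight-≤ y≥0 Ȳ! isW ordering) (≤-reflexive ∑y≡k)
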